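{- Let $n\ge4$, let $p$ be a positive integer and let $m\le\lfloor n^2/4\rfloor$. If $m=p^2$ then $\Theta_n(m)=m+n-2p$; if $m=p(p+1)$ then $\Theta_n(m)=m+n-2p-1$.
   Context: All graphs are finite, simple and undirected. A clique cover of $G=(V,E)$ is a family of vertex sets, each inducing a clique, whose union is $V$ and such that every edge lies in some member. $\theta(G)$ is the minimum size of a clique cover of $G$. For $0\le m\le\binom n2$, $\Theta_n(m)$ is the maximum of $\theta(G)$ over all graphs $G$ with $n$ vertices and $m$ edges. -}

module Defs where

open import Data.Nat using (ℕ; _+_; _≤_; _<ᵇ_)
open import Data.Bool using (Bool; true; false; if_then_else_; _∧_)
open import Data.Fin using (Fin; toℕ)
open import Data.Fin.Subset using (Subset; _∈_)
open import Data.List using (List; length; map; allFin)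
open import Data.Nat.ListAction using (sum)
open import Data.List.Relation.Unary.All using (All)
open import Data.List.Relation.Unary.Any using (Any)
open import Data.Product using (Σ; _×_; ∃)
open import Relation.Binary.PropositionalEquality using (_≡_; _≢_)

record Graph (n : ℕ) : Set where
  field
    adj    : Fin n → Fin n → Bool
    sym    : ∀ i j → adj i j ≡ adj j i
    irrefl : ∀ i → adj i i ≡ false
open Graph public

edgeCount : ∀ {n} → Graph n → ℕ
edgeCount {n} G =
  sum (map (λ i → sum (map (λ j → if (toℕ i <ᵇ toℕ j) ∧ adj G i j then 1 else 0)
                          (allFin n)))
           (allFin n))

IsClique : ∀ {n} → Graph n → Subset n → Set
IsClique G S = ∀ i j → i ∈ S → j ∈ S → i ≢ j → adj G i j ≡ true

IsCliqueCover : ∀ {n} → Graph n → List (Subset n) → Set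
IsCliqueCover {n} G F =
  All (IsClique G) F
  × (∀ (v : Fin n) → Any (λ S → v ∈ S) F)
  × (∀ (i j : Fin n) → adj G i j ≡ true → Any (λ S → i ∈ S × j ∈ S) F)

IsTheta : ∀ {n} → Graph n → ℕ → Set
IsTheta G k =
  Σ (List _) (λ F → IsCliqueCover G F × length F ≡ k)
  × (∀ F → IsCliqueCover G F → k ≤ length F)

IsBigTheta : ℕ → ℕ → ℕ → Set
IsBigTheta n m k =
  Σ (Graph n) (λ G → edgeCount G ≡ m × IsTheta G k)
  × (∀ (G : Graph n) → edgeCount G ≡ m → ∀ k′ → IsTheta G k′ → k′ ≤ k)

-- Upper bound, by induction on t with t² ≤ 4e + 1 and t ≥ 2: if G is triangle-free,
-- Mantel's theorem 4e ≤ k² (k the number of non-isolated vertices) gives t ≤ k, so the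
-- trivial cover by the edges and the isolated vertices, of size e + n − k, saves t on
-- e + n; the same holds when t ≤ 3 and G has a triangle, as then k ≥ 3.  Otherwise delete
-- the three edges of a triangle, cover the rest saving t − 2, and put the triangle back
-- as a single clique.
-- Lower bound: in a triangle-free graph a clique contains at most one edge or one
-- isolated vertex, so every clique cover has at least e + (n − k) members.  For K_{p,q}
-- plus n − p − q isolated vertices this is pq + n − p − q, and (p + q)² ≤ 4pq + 1 holds
-- precisely when q ∈ {p, p + 1}.

module Submission where

open import Defs
open import Data.Nat using (ℕ; _+_; _*_; _∸_; _/_; _≤_)
open import Data.Product using (_×_)
open import Relation.Binary.PropositionalEquality using (_≡_)

open import Data.Bool using (Bool; true; false; if_then_else_; _∧_; _∨_; not)
import Data.Bool.Properties as Boolₚ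
open import Data.Empty using (⊥; ⊥-elim)
open import Data.Fin using (Fin; zero; suc; toℕ; fromℕ<)
import Data.Fin.Properties as Finₚ
open import Data.Fin.Subset using (Subset; _∈_; ⁅_⁆; _∪_)
open import Data.Fin.Subset.Properties using (_∈?_; x∈⁅x⁆; x∈⁅y⁆⇒x≡y; x∈p∪q⁺; x∈p∪q⁻)
open import Data.List using (List; []; _∷_; [_]; length; map; allFin; tabulate; _++_)
import Data.List.Properties as Listₚ
open import Data.List.Relation.Unary.All using (All; []; _∷_)
import Data.List.Relation.Unary.All as All
import Data.List.Relation.Unary.All.Properties as Allₚ
open import Data.List.Relation.Unary.Any using (Any; here; there)
import Data.List.Relation.Unary.Any as Any
import Data.List.Relation.Unary.Any.Properties as Anyₚ
open import Data.Nat using (zero; suc; _<_; _<ᵇ_; _≡ᵇ_; z≤n; s≤s; _≤?_; _<?_)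
open import Data.Nat.DivMod using (m/n*n≤m)
open import Data.Nat.ListAction using (sum)
open import Data.Nat.Properties
open import Data.Nat.Tactic.RingSolver using (solve-∀)
open import Data.Product using (Σ; ∃; _,_; proj₁; proj₂)
open import Data.Sum using (_⊎_; inj₁; inj₂)
import Data.Vec as Vec
import Data.Vec.Properties as Vecₚ
open import Function using (_∘_)
open import Relation.Binary.PropositionalEquality using (refl; trans; cong; cong₂; subst; subst₂; _≢_; module ≡-Reasoning)
import Relation.Binary.PropositionalEquality as ≡
open import Relation.Nullary using (¬_; Dec; yes; no; does)
open import Relation.Nullary.Decidable using (_×-dec_)

open import Algebra.Properties.Semiring.Sum +-*-semiring
  using (sum-cong-≗; ∑-distrib-+; ∑-comm; *-distribˡ-sum; *-distribʳ-sum) renaming (sum to ∑)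

∑-zero : ∀ {n} {f : Fin n → ℕ} → (∀ i → f i ≡ 0) → ∑ f ≡ 0
∑-zero {zero}  h = refl
∑-zero {suc n} h = cong₂ _+_ (h zero) (∑-zero (h ∘ suc))

∑-ones : ∀ n → ∑ {n} (λ _ → 1) ≡ n
∑-ones zero    = refl
∑-ones (suc n) = cong suc (∑-ones n)

∑-mono-≤ : ∀ {n} {f g : Fin n → ℕ} → (∀ i → f i ≤ g i) → ∑ f ≤ ∑ g
∑-mono-≤ {zero}  h = z≤n
∑-mono-≤ {suc n} h = +-mono-≤ (h zero) (∑-mono-≤ (h ∘ suc))

term≤∑ : ∀ {n} (f : Fin n → ℕ) i → f i ≤ ∑ f
term≤∑ f zero    = m≤m+n _ _
term≤∑ f (suc i) = ≤-trans (term≤∑ (f ∘ suc) i) (m≤n+m _ _)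

∑-positive : ∀ {n} (f : Fin n → ℕ) → 0 < ∑ f → ∃ λ i → 0 < f i
∑-positive {suc n} f pos with f zero in eq
... | suc _ = zero , subst (0 <_) (≡.sym eq) (s≤s z≤n)
... | zero  = let (i , p) = ∑-positive (f ∘ suc) pos in suc i , p

∑-*ˡ : ∀ {n} c (f : Fin n → ℕ) → ∑ (λ i → c * f i) ≡ c * ∑ f
∑-*ˡ c f = ≡.sym (*-distribˡ-sum c f)

sum-map-allFin : ∀ {n} (f : Fin n → ℕ) → sum (map f (allFin n)) ≡ ∑ f
sum-map-allFin {n} f = trans (cong sum (Listₚ.map-tabulate (λ i → i) f)) (sum-tabulate f)
  where
  sum-tabulate : ∀ {n} (f : Fin n → ℕ) → sum (tabulate f) ≡ ∑ f
  sum-tabulate {zero}  f = refl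
  sum-tabulate {suc n} f = cong (f zero +_) (sum-tabulate (f ∘ suc))

𝟙 : Bool → ℕ
𝟙 b = if b then 1 else 0

𝟙≤1 : ∀ b → 𝟙 b ≤ 1
𝟙≤1 true  = s≤s z≤n
𝟙≤1 false = z≤n

𝟙-true : ∀ {b} → b ≡ true → 𝟙 b ≡ 1
𝟙-true refl = refl

𝟙-positive : ∀ {b} → 0 < 𝟙 b → b ≡ true
𝟙-positive {true} _ = refl

∧-true⁻ : ∀ {a b} → a ∧ b ≡ true → a ≡ true × b ≡ true
∧-true⁻ {true} {true} _ = refl , refl

∨-true⁻ : ∀ {a b} → a ∨ b ≡ true → a ≡ true ⊎ b ≡ true
∨-true⁻ {true}  _ = inj₁ refl
∨-true⁻ {false} e = inj₂ e

is : ∀ {n} → Fin n → Fin n → Bool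
is u i = does (i Finₚ.≟ u)

is-true⁻ : ∀ {n} {u i : Fin n} → is u i ≡ true → i ≡ u
is-true⁻ {u = u} {i} e with i Finₚ.≟ u
... | yes i≡u = i≡u

is-refl : ∀ {n} (u : Fin n) → is u u ≡ true
is-refl u with u Finₚ.≟ u
... | yes _  = refl
... | no u≢u = ⊥-elim (u≢u refl)

δ : ∀ {n} → Fin n → Fin n → ℕ
δ u i = 𝟙 (is u i)

δ-refl : ∀ {n} (u : Fin n) → δ u u ≡ 1
δ-refl u = cong 𝟙 (is-refl u)

∑-δ* : ∀ {n} (u : Fin n) (g : Fin n → ℕ) → ∑ (λ i → δ u i * g i) ≡ g u
∑-δ* {suc n} zero g = trans (cong₂ _+_ (+-identityʳ (g zero)) (∑-zero {n} (λ _ → refl))) (+-identityʳ (g zero))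
∑-δ* {suc n} (suc u) g = ∑-δ* u (g ∘ suc)

∑-δ : ∀ {n} (u : Fin n) → ∑ (δ u) ≡ 1
∑-δ u = trans (sum-cong-≗ (λ i → ≡.sym (*-identityʳ (δ u i)))) (∑-δ* u (λ _ → 1))

≤δ : ∀ {n} {u i : Fin n} x → x ≤ 1 → (0 < x → i ≡ u) → x ≤ δ u i
≤δ zero          _ _ = z≤n
≤δ {u = u} (suc zero) _ h rewrite h (s≤s z≤n) = ≤-reflexive (≡.sym (δ-refl u))
≤δ (suc (suc x)) (s≤s ()) _

∑-supported≤1 : ∀ {n} {f : Fin n → ℕ} (u : Fin n) → (∀ i → f i ≤ 1) → (∀ i → 0 < f i → i ≡ u) → ∑ f ≤ 1
∑-supported≤1 u f≤1 supp = ≤-trans (∑-mono-≤ (λ i → ≤δ _ (f≤1 i) (supp i))) (≤-reflexive (∑-δ u))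

∑∑-supported≤1 : ∀ {n} {f : Fin n → Fin n → ℕ} (u v : Fin n) → (∀ i j → f i j ≤ 1) →
  (∀ i j → 0 < f i j → i ≡ u × j ≡ v) → ∑ (λ i → ∑ (f i)) ≤ 1
∑∑-supported≤1 {f = f} u v f≤1 supp =
  ∑-supported≤1 u (λ i → ∑-supported≤1 v (f≤1 i) (λ j → proj₂ ∘ supp i j))
    (λ i pos → let (j , p) = ∑-positive (f i) pos in proj₁ (supp i j p))

<ᵇ-true⁻ : ∀ a b → (a <ᵇ b) ≡ true → a < b
<ᵇ-true⁻ a b e = <ᵇ⇒< a b (subst Data.Bool.T (≡.sym e) _)

<ᵇ-false⁻ : ∀ a b → (a <ᵇ b) ≡ false → b ≤ a
<ᵇ-false⁻ a b e = ≮⇒≥ (λ lt → subst Data.Bool.T e (<⇒<ᵇ lt))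

<ᵇ-true⁺ : ∀ {a b} → a < b → (a <ᵇ b) ≡ true
<ᵇ-true⁺ {a} {b} lt with a <ᵇ b | <⇒<ᵇ lt
... | true | _ = refl

<ᵇ-false⁺ : ∀ {a b} → b ≤ a → (a <ᵇ b) ≡ false
<ᵇ-false⁺ {a} {b} le with a <ᵇ b in e
... | false = refl
... | true  = ⊥-elim (<⇒≱ (<ᵇ-true⁻ a b e) le)

∑-<ᵇ : ∀ n a → a ≤ n → ∑ {n} (λ i → 𝟙 (toℕ i <ᵇ a)) ≡ a
∑-<ᵇ zero    zero    _         = refl
∑-<ᵇ (suc n) zero    _         = ∑-zero {suc n} λ _ → refl
∑-<ᵇ (suc n) (suc a) (s≤s a≤n) = cong suc (∑-<ᵇ n a a≤n)

𝟙-∧ : ∀ a b → 𝟙 (a ∧ b) ≡ 𝟙 a * 𝟙 b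
𝟙-∧ true  b = ≡.sym (+-identityʳ (𝟙 b))
𝟙-∧ false b = refl

∧-∨-select : ∀ a b c → (b ≡ true → a ≡ true) → (c ≡ true → a ≡ false) → a ∧ (b ∨ c) ≡ b
∧-∨-select a true  c      b⇒a _   rewrite b⇒a refl = refl
∧-∨-select a false true   _   c⇒¬a rewrite c⇒¬a refl = refl
∧-∨-select a false false  _   _   = Boolₚ.∧-zeroʳ a

module _ {n : ℕ} (G : Graph n) where

  adjacency : Fin n → Fin n → ℕ
  adjacency i j = 𝟙 (adj G i j)

  degree : Fin n → ℕ
  degree i = ∑ (adjacency i)

  isolated : Fin n → Bool
  isolated i = degree i ≡ᵇ 0

  nonIsolated : Fin n → Bool
  nonIsolated i = 0 <ᵇ degree i

  isolatedCount : ℕ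
  isolatedCount = ∑ (𝟙 ∘ isolated)

  nonIsolatedCount : ℕ
  nonIsolatedCount = ∑ (𝟙 ∘ nonIsolated)

  forward : Fin n → Fin n → Bool
  forward i j = (toℕ i <ᵇ toℕ j) ∧ adj G i j

  TriangleFree : Set
  TriangleFree = ∀ x y z → adj G x y ≡ true → adj G y z ≡ true → adj G x z ≡ true → ⊥

adjacency-sym : ∀ {n} (G : Graph n) i j → adjacency G i j ≡ adjacency G j i
adjacency-sym G i j = cong 𝟙 (Graph.sym G i j)

adj⇒≢ : ∀ {n} (G : Graph n) {i j} → adj G i j ≡ true → i ≢ j
adj⇒≢ G {i} e refl with () ← trans (≡.sym (Graph.irrefl G i)) e

adj⇒nonIsolated : ∀ {n} (G : Graph n) {i j} → adj G i j ≡ true → nonIsolated G i ≡ true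
adj⇒nonIsolated G {i} {j} e with term≤∑ (adjacency G i) j
... | le with degree G i
...   | suc _ = refl
...   | zero  = ⊥-elim (subst (λ b → 𝟙 b ≤ 0 → ⊥) (≡.sym e) (λ ()) le)

isolated-¬adj : ∀ {n} (G : Graph n) {v j} → isolated G v ≡ true → adj G v j ≡ true → ⊥
isolated-¬adj G {v} iso e with degree G v | adj⇒nonIsolated G e
isolated-¬adj G () e | suc _ | _

isolatedCount+nonIsolatedCount : ∀ {n} (G : Graph n) → isolatedCount G + nonIsolatedCount G ≡ n
isolatedCount+nonIsolatedCount {n} G = begin
  isolatedCount G + nonIsolatedCount G             ≡⟨ ∑-distrib-+ (𝟙 ∘ isolated G) (𝟙 ∘ nonIsolated G) ⟨
  ∑ (λ i → 𝟙 (isolated G i) + 𝟙 (nonIsolated G i)) ≡⟨ sum-cong-≗ (λ i → exactlyOne (degree G i)) ⟩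
  ∑ {n} (λ _ → 1)                                  ≡⟨ ∑-ones n ⟩
  n                                                ∎
  where
  open ≡-Reasoning
  exactlyOne : ∀ d → 𝟙 (d ≡ᵇ 0) + 𝟙 (0 <ᵇ d) ≡ 1
  exactlyOne zero    = refl
  exactlyOne (suc _) = refl

edgeCount-∑ : ∀ {n} (G : Graph n) → edgeCount G ≡ ∑ (λ i → ∑ (λ j → 𝟙 (forward G i j)))
edgeCount-∑ {n} G =
  trans (sum-map-allFin (λ i → sum (map (𝟙 ∘ forward G i) (allFin n))))
        (sum-cong-≗ (λ i → sum-map-allFin (𝟙 ∘ forward G i)))

adjacency-forward : ∀ {n} (G : Graph n) i j → adjacency G i j ≡ 𝟙 (forward G i j) + 𝟙 (forward G j i)
adjacency-forward G i j with toℕ i <ᵇ toℕ j in i<j | toℕ j <ᵇ toℕ i in j<i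
... | true  | true  = ⊥-elim (<-asym (<ᵇ-true⁻ (toℕ i) _ i<j) (<ᵇ-true⁻ (toℕ j) _ j<i))
... | true  | false = ≡.sym (+-identityʳ _)
... | false | true  = adjacency-sym G i j
... | false | false
  rewrite Finₚ.toℕ-injective {i = i} {j} (≤-antisym (<ᵇ-false⁻ (toℕ j) _ j<i) (<ᵇ-false⁻ (toℕ i) _ i<j))
        | Graph.irrefl G j = refl

handshake : ∀ {n} (G : Graph n) → ∑ (degree G) ≡ edgeCount G + edgeCount G
handshake {n} G = begin
  ∑ (λ i → ∑ (adjacency G i))                   ≡⟨ sum-cong-≗ (λ i → sum-cong-≗ (adjacency-forward G i)) ⟩
  ∑ (λ i → ∑ (λ j → f i j + f j i))            ≡⟨ sum-cong-≗ (λ i → ∑-distrib-+ (f i) (λ j → f j i)) ⟩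
  ∑ (λ i → ∑ (f i) + ∑ (λ j → f j i))          ≡⟨ ∑-distrib-+ (λ i → ∑ (f i)) (λ i → ∑ (λ j → f j i)) ⟩
  ∑ (λ i → ∑ (f i)) + ∑ (λ i → ∑ (λ j → f j i)) ≡⟨ cong (∑ (λ i → ∑ (f i)) +_) (∑-comm (λ i j → f j i)) ⟩
  ∑ (λ i → ∑ (f i)) + ∑ (λ j → ∑ (f j))         ≡⟨ cong₂ _+_ (edgeCount-∑ G) (edgeCount-∑ G) ⟨
  edgeCount G + edgeCount G                     ∎
  where
  open ≡-Reasoning
  f : Fin n → Fin n → ℕ
  f i j = 𝟙 (forward G i j)

fromPred : ∀ {n} → (Fin n → Bool) → Subset n
fromPred = Vec.tabulate

∈fromPred⁺ : ∀ {n} {P : Fin n → Bool} {i} → P i ≡ true → i ∈ fromPred P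
∈fromPred⁺ {P = P} {i} e = Vecₚ.lookup⇒[]= i (Vec.tabulate P) (trans (Vecₚ.lookup∘tabulate P i) e)

∈fromPred⁻ : ∀ {n} {P : Fin n → Bool} {i} → i ∈ fromPred P → P i ≡ true
∈fromPred⁻ {P = P} {i} p = trans (≡.sym (Vecₚ.lookup∘tabulate P i)) (Vecₚ.[]=⇒lookup p)

pair : ∀ {n} → Fin n → Fin n → Subset n
pair u v = ⁅ u ⁆ ∪ ⁅ v ⁆

∈pairˡ : ∀ {n} (u v : Fin n) → u ∈ pair u v
∈pairˡ u v = x∈p∪q⁺ (inj₁ (x∈⁅x⁆ u))

∈pairʳ : ∀ {n} (u v : Fin n) → v ∈ pair u v
∈pairʳ u v = x∈p∪q⁺ (inj₂ (x∈⁅x⁆ v))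

∈pair⁻ : ∀ {n} {u v i : Fin n} → i ∈ pair u v → i ≡ u ⊎ i ≡ v
∈pair⁻ {u = u} {v} p = Data.Sum.map (x∈⁅y⁆⇒x≡y u) (x∈⁅y⁆⇒x≡y v) (x∈p∪q⁻ ⁅ u ⁆ ⁅ v ⁆ p)

concatFin : ∀ {n} {A : Set} → (Fin n → List A) → List A
concatFin {zero}  f = []
concatFin {suc n} f = f zero ++ concatFin (f ∘ suc)

length-concatFin : ∀ {n} {A : Set} (f : Fin n → List A) → length (concatFin f) ≡ ∑ (length ∘ f)
length-concatFin {zero}  f = refl
length-concatFin {suc n} f = trans (Listₚ.length-++ (f zero)) (cong (length (f zero) +_) (length-concatFin (f ∘ suc)))

All-concatFin : ∀ {n} {A : Set} {P : A → Set} (f : Fin n → List A) → (∀ i → All P (f i)) → All P (concatFin f)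
All-concatFin {zero}  f h = []
All-concatFin {suc n} f h = Allₚ.++⁺ (h zero) (All-concatFin (f ∘ suc) (h ∘ suc))

Any-concatFin : ∀ {n} {A : Set} {P : A → Set} (f : Fin n → List A) i → Any P (f i) → Any P (concatFin f)
Any-concatFin f zero    p = Anyₚ.++⁺ˡ p
Any-concatFin f (suc i) p = Anyₚ.++⁺ʳ (f zero) (Any-concatFin (f ∘ suc) i p)

when : ∀ {A : Set} → Bool → A → List A
when b x = if b then [ x ] else []

length-when : ∀ {A : Set} b (x : A) → length (when b x) ≡ 𝟙 b
length-when true  x = refl
length-when false x = refl

All-when : ∀ {A : Set} {P : A → Set} b {x} → (b ≡ true → P x) → All P (when b x)
All-when true  h = h refl ∷ []
All-when false h = []

Any-when : ∀ {A : Set} {P : A → Set} {b x} → b ≡ true → P x → Any P (when b x)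
Any-when refl p = here p

module _ {n : ℕ} (G : Graph n) where

  edgeCliques : List (Subset n)
  edgeCliques = concatFin λ i → concatFin λ j → when (forward G i j) (pair i j)

  isolatedCliques : List (Subset n)
  isolatedCliques = concatFin λ v → when (isolated G v) ⁅ v ⁆

  trivialCover : List (Subset n)
  trivialCover = edgeCliques ++ isolatedCliques

  edge-isClique : ∀ {u v} → adj G u v ≡ true → IsClique G (pair u v)
  edge-isClique e i j i∈ j∈ i≢j with ∈pair⁻ i∈ | ∈pair⁻ j∈
  ... | inj₁ refl | inj₁ refl = ⊥-elim (i≢j refl)
  ... | inj₁ refl | inj₂ refl = e
  ... | inj₂ refl | inj₁ refl = trans (Graph.sym G i j) e
  ... | inj₂ refl | inj₂ refl = ⊥-elim (i≢j refl)

  singleton-isClique : ∀ u → IsClique G ⁅ u ⁆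
  singleton-isClique u i j i∈ j∈ i≢j = ⊥-elim (i≢j (trans (x∈⁅y⁆⇒x≡y u i∈) (≡.sym (x∈⁅y⁆⇒x≡y u j∈))))

  forward-cover : ∀ i j → forward G i j ≡ true → Any (λ S → i ∈ S × j ∈ S) edgeCliques
  forward-cover i j f = Any-concatFin _ i (Any-concatFin _ j (Any-when f (∈pairˡ i j , ∈pairʳ i j)))

  edgeCliques-cover : ∀ i j → adj G i j ≡ true → Any (λ S → i ∈ S × j ∈ S) edgeCliques
  edgeCliques-cover i j e with toℕ i <ᵇ toℕ j in i<j | toℕ j <ᵇ toℕ i in j<i
  ... | true  | _     = forward-cover i j (cong₂ _∧_ i<j e)
  ... | false | true  = Any.map Data.Product.swap (forward-cover j i (cong₂ _∧_ j<i (trans (Graph.sym G j i) e)))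
  ... | false | false =
    ⊥-elim (adj⇒≢ G e (Finₚ.toℕ-injective (≤-antisym (<ᵇ-false⁻ (toℕ j) _ j<i) (<ᵇ-false⁻ (toℕ i) _ i<j))))

  neighbour : ∀ v → isolated G v ≡ false → ∃ λ j → adj G v j ≡ true
  neighbour v iso = let (j , pos) = ∑-positive (adjacency G v) (positive (degree G v) iso) in j , 𝟙-positive pos
    where
    positive : ∀ d → (d ≡ᵇ 0) ≡ false → 0 < d
    positive (suc d) _ = s≤s z≤n

  vertex-cover : ∀ v → Any (v ∈_) trivialCover
  vertex-cover v with isolated G v in iso
  ... | true  = Anyₚ.++⁺ʳ edgeCliques (Any-concatFin _ v (Any-when iso (x∈⁅x⁆ v)))
  ... | false = let (j , e) = neighbour v iso in Anyₚ.++⁺ˡ (Any.map proj₁ (edgeCliques-cover v j e))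

  trivialCover-isCliqueCover : IsCliqueCover G trivialCover
  trivialCover-isCliqueCover =
    Allₚ.++⁺ (All-concatFin _ λ i → All-concatFin _ λ j →
                All-when (forward G i j) (edge-isClique ∘ proj₂ ∘ ∧-true⁻))
             (All-concatFin _ λ v → All-when (isolated G v) λ _ → singleton-isClique v) ,
    vertex-cover ,
    λ i j e → Anyₚ.++⁺ˡ (edgeCliques-cover i j e)

  length-trivialCover : length trivialCover ≡ edgeCount G + isolatedCount G
  length-trivialCover = begin
    length trivialCover                                     ≡⟨ Listₚ.length-++ edgeCliques ⟩
    length edgeCliques + length isolatedCliques             ≡⟨ cong₂ _+_ lengthEdges lengthIsolated ⟩
    ∑ (λ i → ∑ (λ j → 𝟙 (forward G i j))) + isolatedCount G ≡⟨ cong (_+ isolatedCount G) (edgeCount-∑ G) ⟨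
    edgeCount G + isolatedCount G                           ∎
    where
    open ≡-Reasoning
    lengthEdges : length edgeCliques ≡ ∑ (λ i → ∑ (λ j → 𝟙 (forward G i j)))
    lengthEdges =
      trans (length-concatFin λ i → concatFin λ j → when (forward G i j) (pair i j)) (sum-cong-≗ λ i →
        trans (length-concatFin λ j → when (forward G i j) (pair i j))
              (sum-cong-≗ λ j → length-when (forward G i j) (pair i j)))
    lengthIsolated : length isolatedCliques ≡ isolatedCount G
    lengthIsolated =
      trans (length-concatFin λ v → when (isolated G v) ⁅ v ⁆) (sum-cong-≗ λ v → length-when (isolated G v) ⁅ v ⁆)

-- Lower bound for triangle-free graphs

∑ₗ : ∀ {A : Set} → List A → (A → ℕ) → ℕ
∑ₗ F g = sum (map g F)

∑ₗ-ones : ∀ {A : Set} (F : List A) → ∑ₗ F (λ _ → 1) ≡ length F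
∑ₗ-ones []      = refl
∑ₗ-ones (S ∷ F) = cong suc (∑ₗ-ones F)

∑ₗ-distrib-+ : ∀ {A : Set} (F : List A) (g h : A → ℕ) → ∑ₗ F (λ S → g S + h S) ≡ ∑ₗ F g + ∑ₗ F h
∑ₗ-distrib-+ []      g h = refl
∑ₗ-distrib-+ (S ∷ F) g h = trans (cong (g S + h S +_) (∑ₗ-distrib-+ F g h)) (interchange (g S) (h S) _ _)
  where
  interchange : ∀ a b c d → (a + b) + (c + d) ≡ (a + c) + (b + d)
  interchange = solve-∀

∑ₗ-∑ : ∀ {n} {A : Set} (F : List A) (h : A → Fin n → ℕ) → ∑ₗ F (λ S → ∑ (h S)) ≡ ∑ (λ i → ∑ₗ F (λ S → h S i))
∑ₗ-∑ {n} []      h = ≡.sym (∑-zero {n} λ _ → refl)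
∑ₗ-∑     (S ∷ F) h = trans (cong (∑ (h S) +_) (∑ₗ-∑ F h)) (≡.sym (∑-distrib-+ (h S) _))

∑ₗ-mono-All : ∀ {A : Set} {P : A → Set} {F : List A} {g h : A → ℕ} → All P F → (∀ {S} → P S → g S ≤ h S) →
  ∑ₗ F g ≤ ∑ₗ F h
∑ₗ-mono-All []       le = z≤n
∑ₗ-mono-All (p ∷ ps) le = +-mono-≤ (le p) (∑ₗ-mono-All ps le)

Any⇒1≤∑ₗ : ∀ {A : Set} {P : A → Set} {F : List A} (g : A → ℕ) → Any P F → (∀ {S} → P S → 1 ≤ g S) → 1 ≤ ∑ₗ F g
Any⇒1≤∑ₗ g (here p)  h = ≤-trans (h p) (m≤m+n _ _)
Any⇒1≤∑ₗ g (there a) h = ≤-trans (Any⇒1≤∑ₗ g a h) (m≤n+m _ _)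

inside : ∀ {n} → Subset n → Fin n → Bool
inside S i = does (i ∈? S)

inside-true⁻ : ∀ {n} {S : Subset n} {i} → inside S i ≡ true → i ∈ S
inside-true⁻ {S = S} {i} e with i ∈? S
... | yes i∈S = i∈S

inside-true⁺ : ∀ {n} {S : Subset n} {i} → i ∈ S → inside S i ≡ true
inside-true⁺ {S = S} {i} i∈S with i ∈? S
... | yes _   = refl
... | no i∉S = ⊥-elim (i∉S i∈S)

module _ {n : ℕ} (G : Graph n) where

  edgesIn : Subset n → Fin n → Fin n → ℕ
  edgesIn S i j = 𝟙 (forward G i j ∧ (inside S i ∧ inside S j))

  isolatedIn : Subset n → Fin n → ℕ
  isolatedIn S v = 𝟙 (isolated G v ∧ inside S v)

  weight : Subset n → ℕ
  weight S = ∑ (λ i → ∑ (edgesIn S i)) + ∑ (isolatedIn S)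

  edgesIn-positive : ∀ {S i j} → 0 < edgesIn S i j → toℕ i < toℕ j × adj G i j ≡ true × i ∈ S × j ∈ S
  edgesIn-positive {S} {i} {j} pos =
    let (f , ins) = ∧-true⁻ (𝟙-positive pos)
        (i<j , e) = ∧-true⁻ {toℕ i <ᵇ toℕ j} f
        (i∈ , j∈) = ∧-true⁻ ins
    in <ᵇ-true⁻ (toℕ i) _ i<j , e , inside-true⁻ i∈ , inside-true⁻ j∈

  isolatedIn-positive : ∀ {S v} → 0 < isolatedIn S v → isolated G v ≡ true × v ∈ S
  isolatedIn-positive pos = let (iso , v∈) = ∧-true⁻ (𝟙-positive pos) in iso , inside-true⁻ v∈

  clique∋isolated : ∀ {S v} → IsClique G S → isolated G v ≡ true → v ∈ S → ∀ {u} → u ∈ S → u ≡ v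
  clique∋isolated {v = v} cl iso v∈ {u} u∈ with u Finₚ.≟ v
  ... | yes u≡v = u≡v
  ... | no  u≢v = ⊥-elim (isolated-¬adj G iso (cl _ u v∈ u∈ (u≢v ∘ ≡.sym)))

  clique∋edge : ∀ {S x y} → TriangleFree G → IsClique G S → adj G x y ≡ true → x ∈ S → y ∈ S →
    ∀ {u} → u ∈ S → u ≡ x ⊎ u ≡ y
  clique∋edge {x = x} {y} tf cl e x∈ y∈ {u} u∈ with u Finₚ.≟ x | u Finₚ.≟ y
  ... | yes u≡x | _       = inj₁ u≡x
  ... | no  _   | yes u≡y = inj₂ u≡y
  ... | no  u≢x | no  u≢y = ⊥-elim (tf x u y (cl x u x∈ u∈ (u≢x ∘ ≡.sym)) (cl u y u∈ y∈ u≢y) e)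

  weight-isolated≤1 : ∀ {S v} → IsClique G S → isolated G v ≡ true → v ∈ S → weight S ≤ 1
  weight-isolated≤1 {S} {v} cl iso v∈ = begin
    ∑ (λ i → ∑ (edgesIn S i)) + ∑ (isolatedIn S)
      ≡⟨ cong (_+ ∑ (isolatedIn S)) (∑-zero λ i → ∑-zero (noEdge i)) ⟩
    ∑ (isolatedIn S)
      ≤⟨ ∑-supported≤1 v (λ u → 𝟙≤1 _) (λ u → onlyV ∘ proj₂ ∘ isolatedIn-positive) ⟩
    1 ∎
    where
    open ≤-Reasoning
    onlyV : ∀ {u} → u ∈ S → u ≡ v
    onlyV = clique∋isolated cl iso v∈
    noEdge : ∀ i j → edgesIn S i j ≡ 0
    noEdge i j with edgesIn S i j in eq
    ... | zero  = refl
    ... | suc _ with edgesIn-positive (subst (0 <_) (≡.sym eq) (s≤s z≤n))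
    ...   | _ , e , i∈ , _ = ⊥-elim (isolated-¬adj G iso (subst (λ x → adj G x j ≡ true) (onlyV i∈) e))

  edgeWeight≤1 : ∀ {S} → TriangleFree G → IsClique G S → ∑ (λ i → ∑ (edgesIn S i)) ≤ 1
  edgeWeight≤1 {S} tf cl with 0 <? ∑ (λ i → ∑ (edgesIn S i))
  ... | no  ¬pos = ≤-trans (≮⇒≥ ¬pos) z≤n
  ... | yes pos with ∑-positive (λ i → ∑ (edgesIn S i)) pos
  ...   | x , posX with ∑-positive (edgesIn S x) posX
  ...     | y , posXY with edgesIn-positive posXY
  ...       | x<y , xy , x∈ , y∈ = ∑∑-supported≤1 x y (λ i j → 𝟙≤1 _) onlyXY
    where
    members : ∀ {u} → u ∈ S → u ≡ x ⊎ u ≡ y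
    members = clique∋edge tf cl xy x∈ y∈
    onlyXY : ∀ i j → 0 < edgesIn S i j → i ≡ x × j ≡ y
    onlyXY i j pos with edgesIn-positive pos
    ... | i<j , _ , i∈ , j∈ with members i∈ | members j∈
    ...   | inj₁ i≡x  | inj₂ j≡y  = i≡x , j≡y
    ...   | inj₁ refl | inj₁ refl = ⊥-elim (<-irrefl refl i<j)
    ...   | inj₂ refl | inj₂ refl = ⊥-elim (<-irrefl refl i<j)
    ...   | inj₂ refl | inj₁ refl = ⊥-elim (<-asym i<j x<y)

  clique-weight≤1 : ∀ {S} → TriangleFree G → IsClique G S → weight S ≤ 1
  clique-weight≤1 {S} tf cl with 0 <? ∑ (isolatedIn S)
  ... | yes pos = let (v , p) = ∑-positive (isolatedIn S) pos ; (iso , v∈) = isolatedIn-positive p in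
                  weight-isolated≤1 cl iso v∈
  ... | no ¬pos = begin
    ∑ (λ i → ∑ (edgesIn S i)) + ∑ (isolatedIn S) ≡⟨ cong (∑ (λ i → ∑ (edgesIn S i)) +_) (n≤0⇒n≡0 (≮⇒≥ ¬pos)) ⟩
    ∑ (λ i → ∑ (edgesIn S i)) + 0                ≡⟨ +-identityʳ _ ⟩
    ∑ (λ i → ∑ (edgesIn S i))                    ≤⟨ edgeWeight≤1 tf cl ⟩
    1                                            ∎
    where open ≤-Reasoning

  forward≤cover : ∀ {F} → IsCliqueCover G F → ∀ i j → 𝟙 (forward G i j) ≤ ∑ₗ F (λ S → edgesIn S i j)
  forward≤cover (_ , _ , edges) i j with forward G i j in f
  ... | false = z≤n
  ... | true  = Any⇒1≤∑ₗ (λ S → 𝟙 (inside S i ∧ inside S j)) (edges i j (proj₂ (∧-true⁻ f))) λ (i∈ , j∈) →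
                  ≤-reflexive (≡.sym (𝟙-true (cong₂ _∧_ (inside-true⁺ i∈) (inside-true⁺ j∈))))

  isolated≤cover : ∀ {F} → IsCliqueCover G F → ∀ v → 𝟙 (isolated G v) ≤ ∑ₗ F (λ S → isolatedIn S v)
  isolated≤cover (_ , vertices , _) v with isolated G v in iso
  ... | false = z≤n
  ... | true  = Any⇒1≤∑ₗ (λ S → 𝟙 (inside S v)) (vertices v) λ v∈ →
                  ≤-reflexive (≡.sym (𝟙-true (inside-true⁺ v∈)))

  triangleFree-cover-length : TriangleFree G → ∀ {F} → IsCliqueCover G F → edgeCount G + isolatedCount G ≤ length F
  triangleFree-cover-length tf {F} cov = begin
    edgeCount G + isolatedCount G
      ≡⟨ cong (_+ isolatedCount G) (edgeCount-∑ G) ⟩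
    ∑ (λ i → ∑ (λ j → 𝟙 (forward G i j))) + ∑ (𝟙 ∘ isolated G)
      ≤⟨ +-mono-≤ (∑-mono-≤ λ i → ∑-mono-≤ (forward≤cover cov i)) (∑-mono-≤ (isolated≤cover cov)) ⟩
    ∑ (λ i → ∑ (λ j → ∑ₗ F (λ S → edgesIn S i j))) + ∑ (λ v → ∑ₗ F (λ S → isolatedIn S v))
      ≡⟨ cong₂ _+_ (trans (∑ₗ-∑ F λ S i → ∑ (edgesIn S i)) (sum-cong-≗ λ i → ∑ₗ-∑ F (λ S → edgesIn S i)))
                   (∑ₗ-∑ F isolatedIn) ⟨
    ∑ₗ F (λ S → ∑ (λ i → ∑ (edgesIn S i))) + ∑ₗ F (λ S → ∑ (isolatedIn S))
      ≡⟨ ∑ₗ-distrib-+ F _ _ ⟨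
    ∑ₗ F weight
      ≤⟨ ∑ₗ-mono-All (proj₁ cov) (clique-weight≤1 tf) ⟩
    ∑ₗ F (λ _ → 1)
      ≡⟨ ∑ₗ-ones F ⟩
    length F ∎
    where open ≤-Reasoning

-- Mantel's theorem

module Mantel {n : ℕ} (G : Graph n) (tf : TriangleFree G) where

  mass : (Fin n → ℕ) → Fin n → ℕ
  mass g i = ∑ (λ j → g j * adjacency G i j)

  -- For an indicator f = 𝟙 ∘ b this counts every edge inside b twice.
  quadForm : (Fin n → ℕ) → ℕ
  quadForm f = ∑ (λ i → f i * mass f i)

  HasEdge : (Fin n → Bool) → Set
  HasEdge b = ∃ λ u → ∃ λ v → b u ≡ true × b v ≡ true × adj G u v ≡ true

  hasEdge? : ∀ b → Dec (HasEdge b)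
  hasEdge? b = Finₚ.any? λ u → Finₚ.any? λ v →
    (b u Boolₚ.≟ true) ×-dec (b v Boolₚ.≟ true) ×-dec (adj G u v Boolₚ.≟ true)

  quadForm-edgeless : ∀ b → ¬ HasEdge b → quadForm (𝟙 ∘ b) ≡ 0
  quadForm-edgeless b noEdge = ∑-zero term
    where
    term : ∀ i → 𝟙 (b i) * mass (𝟙 ∘ b) i ≡ 0
    term i with b i in bi
    ... | false = refl
    ... | true  = trans (+-identityʳ _) (∑-zero summand)
      where
      summand : ∀ j → 𝟙 (b j) * adjacency G i j ≡ 0
      summand j with b j in bj | adj G i j in e
      ... | false | _     = refl
      ... | true  | false = refl
      ... | true  | true  = ⊥-elim (noEdge (i , j , bi , bj , e))

  module DeleteEdge (b : Fin n → Bool) {u v : Fin n} (bu : b u ≡ true) (bv : b v ≡ true) (e : adj G u v ≡ true) where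

    b⁻ : Fin n → Bool
    b⁻ i = b i ∧ not (is u i) ∧ not (is v i)

    f : Fin n → ℕ
    f = 𝟙 ∘ b⁻

    d : Fin n → ℕ
    d i = δ u i + δ v i

    split : ∀ i → 𝟙 (b i) ≡ f i + d i
    split i with i Finₚ.≟ u | i Finₚ.≟ v
    ... | yes refl | yes refl = ⊥-elim (adj⇒≢ G e refl)
    ... | yes refl | no _ rewrite bu = refl
    ... | no _ | yes refl rewrite bv = refl
    ... | no _ | no _ with b i
    ...   | true  = refl
    ...   | false = refl

    ∑-split : ∑ (𝟙 ∘ b) ≡ 2 + ∑ f
    ∑-split = begin
      ∑ (𝟙 ∘ b)           ≡⟨ sum-cong-≗ split ⟩
      ∑ (λ i → f i + d i) ≡⟨ ∑-distrib-+ f d ⟩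
      ∑ f + ∑ d           ≡⟨ cong (∑ f +_) (trans (∑-distrib-+ (δ u) (δ v)) (cong₂ _+_ (∑-δ u) (∑-δ v))) ⟩
      ∑ f + 2             ≡⟨ +-comm (∑ f) 2 ⟩
      2 + ∑ f             ∎
      where open ≡-Reasoning

    ∑-d* : ∀ (h : Fin n → ℕ) → ∑ (λ i → d i * h i) ≡ h u + h v
    ∑-d* h = trans (sum-cong-≗ λ i → *-distribʳ-+ (h i) (δ u i) (δ v i))
               (trans (∑-distrib-+ (λ i → δ u i * h i) (λ i → δ v i * h i)) (cong₂ _+_ (∑-δ* u h) (∑-δ* v h)))

    endpoints : Fin n → ℕ
    endpoints i = adjacency G i u + adjacency G i v

    mass-split : ∀ i → mass (𝟙 ∘ b) i ≡ mass f i + endpoints i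
    mass-split i =
      trans (sum-cong-≗ λ j → trans (cong (_* adjacency G i j) (split j)) (*-distribʳ-+ (adjacency G i j) (f j) (d j)))
        (trans (∑-distrib-+ (λ j → f j * adjacency G i j) (λ j → d j * adjacency G i j))
               (cong (mass f i +_) (∑-d* (adjacency G i))))

    commonNeighbour≤1 : ∀ j → adjacency G u j + adjacency G v j ≤ 1
    commonNeighbour≤1 j with adj G u j in uj | adj G v j in vj
    ... | true  | true  = ⊥-elim (tf u j v uj (trans (Graph.sym G j v) vj) e)
    ... | true  | false = s≤s z≤n
    ... | false | true  = s≤s z≤n
    ... | false | false = z≤n

    *≤1 : ∀ x c → c ≤ 1 → x * c ≤ x
    *≤1 x c c≤1 = ≤-trans (*-monoʳ-≤ x c≤1) (≤-reflexive (*-identityʳ x))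

    endpoints-mass≤ : ∑ (λ i → f i * endpoints i) ≤ ∑ f
    endpoints-mass≤ = ∑-mono-≤ λ i → *≤1 (f i) (endpoints i)
      (subst (_≤ 1) (cong₂ _+_ (adjacency-sym G u i) (adjacency-sym G v i)) (commonNeighbour≤1 i))

    mass-endpoints≤ : mass f u + mass f v ≤ ∑ f
    mass-endpoints≤ = begin
      mass f u + mass f v
        ≡⟨ ∑-distrib-+ (λ j → f j * adjacency G u j) (λ j → f j * adjacency G v j) ⟨
      ∑ (λ j → f j * adjacency G u j + f j * adjacency G v j)
        ≡⟨ sum-cong-≗ (λ j → *-distribˡ-+ (f j) (adjacency G u j) (adjacency G v j)) ⟨
      ∑ (λ j → f j * (adjacency G u j + adjacency G v j))
        ≤⟨ ∑-mono-≤ (λ j → *≤1 (f j) _ (commonNeighbour≤1 j)) ⟩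
      ∑ f ∎
      where open ≤-Reasoning

    endpoints-uv : endpoints u + endpoints v ≡ 2
    endpoints-uv rewrite Graph.irrefl G u | Graph.irrefl G v | e | Graph.sym G v u | e = refl

    quadForm-split : quadForm (𝟙 ∘ b) ≤ quadForm f + ∑ f + (∑ f + 2)
    quadForm-split = begin
      quadForm (𝟙 ∘ b)
        ≡⟨ sum-cong-≗ (λ i → trans (cong₂ _*_ (split i) (mass-split i))
                                   (*-distribʳ-+ (mass f i + endpoints i) (f i) (d i))) ⟩
      ∑ (λ i → f i * (mass f i + endpoints i) + d i * (mass f i + endpoints i))
        ≡⟨ ∑-distrib-+ (λ i → f i * (mass f i + endpoints i)) (λ i → d i * (mass f i + endpoints i)) ⟩
      ∑ (λ i → f i * (mass f i + endpoints i)) + ∑ (λ i → d i * (mass f i + endpoints i))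
        ≡⟨ cong₂ _+_ (trans (sum-cong-≗ λ i → *-distribˡ-+ (f i) (mass f i) (endpoints i))
                            (∑-distrib-+ (λ i → f i * mass f i) (λ i → f i * endpoints i)))
                     (∑-d* (λ i → mass f i + endpoints i)) ⟩
      (quadForm f + ∑ (λ i → f i * endpoints i)) + ((mass f u + endpoints u) + (mass f v + endpoints v))
        ≡⟨ cong ((quadForm f + ∑ (λ i → f i * endpoints i)) +_)
                (interchange (mass f u) (endpoints u) (mass f v) (endpoints v)) ⟩
      (quadForm f + ∑ (λ i → f i * endpoints i)) + ((mass f u + mass f v) + (endpoints u + endpoints v))
        ≤⟨ +-mono-≤ (+-monoʳ-≤ (quadForm f) endpoints-mass≤) (+-mono-≤ mass-endpoints≤ (≤-reflexive endpoints-uv)) ⟩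
      quadForm f + ∑ f + (∑ f + 2) ∎
      where
      open ≤-Reasoning
      interchange : ∀ a b c d → (a + b) + (c + d) ≡ (a + c) + (b + d)
      interchange = solve-∀

  induced-mantel : ∀ s b → ∑ (𝟙 ∘ b) ≡ s → 2 * quadForm (𝟙 ∘ b) ≤ s * s
  induced-mantel s b size with hasEdge? b
  ... | no noEdge = subst (λ x → 2 * x ≤ s * s) (≡.sym (quadForm-edgeless b noEdge)) z≤n
  induced-mantel s b size | yes (u , v , bu , bv , e) with trans (≡.sym (DeleteEdge.∑-split b bu bv e)) size
  induced-mantel (suc (suc s)) b size | yes (u , v , bu , bv , e) | size⁻ =
    subst (λ t → 2 * quadForm (𝟙 ∘ b) ≤ (2 + t) * (2 + t)) ∑f≡s
      (≤-trans (*-monoʳ-≤ 2 quadForm-split)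
               (grow (quadForm f) (∑ f) (subst (λ t → 2 * quadForm f ≤ t * t) (≡.sym ∑f≡s) (induced-mantel s b⁻ ∑f≡s))))
    where
    open DeleteEdge b bu bv e
    ∑f≡s : ∑ f ≡ s
    ∑f≡s = suc-injective (suc-injective size⁻)
    grow : ∀ q s → 2 * q ≤ s * s → 2 * (q + s + (s + 2)) ≤ (2 + s) * (2 + s)
    grow q s h = subst₂ _≤_ (≡.sym (lhs q s)) (rhs s) (+-monoˡ-≤ (4 * s + 4) h)
      where
      lhs : ∀ q s → 2 * (q + s + (s + 2)) ≡ 2 * q + (4 * s + 4)
      lhs = solve-∀
      rhs : ∀ s → s * s + (4 * s + 4) ≡ (2 + s) * (2 + s)
      rhs = solve-∀

mantel : ∀ {n} (G : Graph n) → TriangleFree G → 4 * edgeCount G ≤ nonIsolatedCount G * nonIsolatedCount G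
mantel G tf = subst (_≤ nonIsolatedCount G * nonIsolatedCount G) quadForm-nonIsolated
  (induced-mantel (nonIsolatedCount G) (nonIsolated G) refl)
  where
  open Mantel G tf
  restrict : ∀ i j → 𝟙 (nonIsolated G j) * adjacency G i j ≡ adjacency G i j
  restrict i j with adj G i j in e
  ... | false = *-zeroʳ (𝟙 (nonIsolated G j))
  ... | true  rewrite adj⇒nonIsolated G (trans (Graph.sym G j i) e) = refl
  restrict-degree : ∀ i → 𝟙 (nonIsolated G i) * degree G i ≡ degree G i
  restrict-degree i with degree G i
  ... | zero  = refl
  ... | suc _ = +-identityʳ _
  quadForm-nonIsolated : 2 * quadForm (𝟙 ∘ nonIsolated G) ≡ 4 * edgeCount G
  quadForm-nonIsolated = begin
    2 * quadForm (𝟙 ∘ nonIsolated G) ≡⟨ cong (2 *_) (sum-cong-≗ λ i →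
                                          trans (cong (𝟙 (nonIsolated G i) *_) (sum-cong-≗ (restrict i)))
                                                (restrict-degree i)) ⟩
    2 * ∑ (degree G)                 ≡⟨ cong (2 *_) (handshake G) ⟩
    2 * (edgeCount G + edgeCount G)  ≡⟨ double (edgeCount G) ⟩
    4 * edgeCount G                  ∎
    where
    open ≡-Reasoning
    double : ∀ m → 2 * (m + m) ≡ 4 * m
    double = solve-∀

-- Upper bound

-- A clique cover of size at most e + n − t, stated without truncated subtraction.
CliqueCoverSaving : ∀ {n} → Graph n → ℕ → Set
CliqueCoverSaving {n} G t = Σ (List (Subset n)) λ F → IsCliqueCover G F × length F + t ≤ edgeCount G + n

trivialCover-saving : ∀ {n} (G : Graph n) {t} → t ≤ nonIsolatedCount G → CliqueCoverSaving G t
trivialCover-saving {n} G {t} t≤k = trivialCover G , trivialCover-isCliqueCover G , (begin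
  length (trivialCover G) + t                          ≡⟨ cong (_+ t) (length-trivialCover G) ⟩
  edgeCount G + isolatedCount G + t                    ≡⟨ +-assoc (edgeCount G) (isolatedCount G) t ⟩
  edgeCount G + (isolatedCount G + t)                  ≤⟨ +-monoʳ-≤ (edgeCount G) (+-monoʳ-≤ (isolatedCount G) t≤k) ⟩
  edgeCount G + (isolatedCount G + nonIsolatedCount G) ≡⟨ cong (edgeCount G +_) (isolatedCount+nonIsolatedCount G) ⟩
  edgeCount G + n                                      ∎)
  where open ≤-Reasoning

module _ {n : ℕ} (G : Graph n) (P : Fin n → Bool) where

  removeWithin : Graph n
  removeWithin = record
    { adj    = λ i j → adj G i j ∧ not (P i ∧ P j)
    ; sym    = λ i j → cong₂ (λ a b → a ∧ not b) (Graph.sym G i j) (Boolₚ.∧-comm (P i) (P j))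
    ; irrefl = λ i → cong (λ a → a ∧ not (P i ∧ P i)) (Graph.irrefl G i)
    }

  adjacency-removeWithin : ∀ i j → adjacency G i j ≡ adjacency removeWithin i j + 𝟙 (P i) * (𝟙 (P j) * adjacency G i j)
  adjacency-removeWithin i j with adj G i j | P i | P j
  ... | false | true  | true  = refl
  ... | false | true  | false = refl
  ... | false | false | _     = refl
  ... | true  | true  | true  = refl
  ... | true  | true  | false = refl
  ... | true  | false | _     = refl

  edgeCount-removeWithin : edgeCount G + edgeCount G ≡
    (edgeCount removeWithin + edgeCount removeWithin) + ∑ (λ i → 𝟙 (P i) * ∑ (λ j → 𝟙 (P j) * adjacency G i j))
  edgeCount-removeWithin = begin
    edgeCount G + edgeCount G
      ≡⟨ handshake G ⟨
    ∑ (λ i → ∑ (adjacency G i))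
      ≡⟨ sum-cong-≗ (λ i → trans (sum-cong-≗ (adjacency-removeWithin i))
                                  (∑-distrib-+ (adjacency removeWithin i) (λ j → 𝟙 (P i) * (𝟙 (P j) * adjacency G i j)))) ⟩
    ∑ (λ i → ∑ (adjacency removeWithin i) + ∑ (λ j → 𝟙 (P i) * (𝟙 (P j) * adjacency G i j)))
      ≡⟨ ∑-distrib-+ (degree removeWithin) _ ⟩
    ∑ (degree removeWithin) + ∑ (λ i → ∑ (λ j → 𝟙 (P i) * (𝟙 (P j) * adjacency G i j)))
      ≡⟨ cong₂ _+_ (handshake removeWithin) (sum-cong-≗ λ i → ∑-*ˡ (𝟙 (P i)) (λ j → 𝟙 (P j) * adjacency G i j)) ⟩
    (edgeCount removeWithin + edgeCount removeWithin) + ∑ (λ i → 𝟙 (P i) * ∑ (λ j → 𝟙 (P j) * adjacency G i j))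
      ∎
    where open ≡-Reasoning

  removeWithin-cover : ∀ {F} → IsClique G (fromPred P) → IsCliqueCover removeWithin F → IsCliqueCover G (fromPred P ∷ F)
  removeWithin-cover {F} clP (cliques , vertices , edges) =
    clP ∷ All.map (λ cl i j i∈ j∈ i≢j → proj₁ (∧-true⁻ (cl i j i∈ j∈ i≢j))) cliques ,
    there ∘ vertices ,
    edges⁺
    where
    edges⁺ : ∀ i j → adj G i j ≡ true → Any (λ S → i ∈ S × j ∈ S) (fromPred P ∷ F)
    edges⁺ i j e with P i ∧ P j in both
    ... | true  = here (∈fromPred⁺ (proj₁ (∧-true⁻ both)) , ∈fromPred⁺ (proj₂ (∧-true⁻ both)))
    ... | false = there (edges i j (cong₂ (λ a b → a ∧ not b) e both))

module Triangle {n : ℕ} (G : Graph n) {x y z : Fin n}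
  (xy : adj G x y ≡ true) (yz : adj G y z ≡ true) (xz : adj G x z ≡ true) where

  corner : Fin n → Bool
  corner i = is x i ∨ is y i ∨ is z i

  triangle : Subset n
  triangle = fromPred corner

  G⁻ : Graph n
  G⁻ = removeWithin G corner

  corner⁻ : ∀ {i} → corner i ≡ true → i ≡ x ⊎ i ≡ y ⊎ i ≡ z
  corner⁻ c with ∨-true⁻ c
  ... | inj₁ ix = inj₁ (is-true⁻ ix)
  ... | inj₂ c′ = inj₂ (Data.Sum.map is-true⁻ is-true⁻ (∨-true⁻ c′))

  𝟙-corner : ∀ i → 𝟙 (corner i) ≡ δ x i + (δ y i + δ z i)
  𝟙-corner i with i Finₚ.≟ x | i Finₚ.≟ y | i Finₚ.≟ z
  ... | yes refl | yes refl | _        = ⊥-elim (adj⇒≢ G xy refl)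
  ... | yes refl | no _     | yes refl = ⊥-elim (adj⇒≢ G xz refl)
  ... | yes refl | no _     | no _     = refl
  ... | no _     | yes refl | yes refl = ⊥-elim (adj⇒≢ G yz refl)
  ... | no _     | yes refl | no _     = refl
  ... | no _     | no _     | yes refl = refl
  ... | no _     | no _     | no _     = refl

  ∑-corner* : ∀ (h : Fin n → ℕ) → ∑ (λ i → 𝟙 (corner i) * h i) ≡ h x + (h y + h z)
  ∑-corner* h = begin
    ∑ (λ i → 𝟙 (corner i) * h i)
      ≡⟨ sum-cong-≗ (λ i → trans (cong (_* h i) (𝟙-corner i))
                          (trans (*-distribʳ-+ (h i) (δ x i) (δ y i + δ z i))
                                 (cong (δ x i * h i +_) (*-distribʳ-+ (h i) (δ y i) (δ z i))))) ⟩
    ∑ (λ i → δ x i * h i + (δ y i * h i + δ z i * h i))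
      ≡⟨ trans (∑-distrib-+ (λ i → δ x i * h i) _) (cong (_ +_) (∑-distrib-+ (λ i → δ y i * h i) _)) ⟩
    ∑ (λ i → δ x i * h i) + (∑ (λ i → δ y i * h i) + ∑ (λ i → δ z i * h i))
      ≡⟨ cong₂ _+_ (∑-δ* x h) (cong₂ _+_ (∑-δ* y h) (∑-δ* z h)) ⟩
    h x + (h y + h z) ∎
    where open ≡-Reasoning

  internal≡6 : ∑ (λ i → 𝟙 (corner i) * ∑ (λ j → 𝟙 (corner j) * adjacency G i j)) ≡ 6
  internal≡6
    rewrite ∑-corner* (λ i → ∑ (λ j → 𝟙 (corner j) * adjacency G i j))
          | ∑-corner* (adjacency G x) | ∑-corner* (adjacency G y) | ∑-corner* (adjacency G z)
          | Graph.irrefl G x | Graph.irrefl G y | Graph.irrefl G z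
          | Graph.sym G y x | Graph.sym G z x | Graph.sym G z y | xy | yz | xz = refl

  edgeCount-G⁻ : edgeCount G ≡ edgeCount G⁻ + 3
  edgeCount-G⁻ =
    +-cancel-double (trans (edgeCount-removeWithin G corner) (cong ((edgeCount G⁻ + edgeCount G⁻) +_) internal≡6))
    where
    +-cancel-double : ∀ {a b} → a + a ≡ (b + b) + 6 → a ≡ b + 3
    +-cancel-double {a} {b} h = *-cancelˡ-≡ a (b + 3) 2 (trans (twice a) (trans h (twice+6 b)))
      where
      twice : ∀ a → 2 * a ≡ a + a
      twice = solve-∀
      twice+6 : ∀ b → (b + b) + 6 ≡ 2 * (b + 3)
      twice+6 = solve-∀

  triangle-isClique : IsClique G triangle
  triangle-isClique i j i∈ j∈ i≢j with corner⁻ {i} (∈fromPred⁻ i∈) | corner⁻ {j} (∈fromPred⁻ j∈)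
  ... | inj₁ refl        | inj₂ (inj₁ refl) = xy
  ... | inj₁ refl        | inj₂ (inj₂ refl) = xz
  ... | inj₂ (inj₁ refl) | inj₁ refl        = trans (Graph.sym G y x) xy
  ... | inj₂ (inj₁ refl) | inj₂ (inj₂ refl) = yz
  ... | inj₂ (inj₂ refl) | inj₁ refl        = trans (Graph.sym G z x) xz
  ... | inj₂ (inj₂ refl) | inj₂ (inj₁ refl) = trans (Graph.sym G z y) yz
  ... | inj₁ refl        | inj₁ refl        = ⊥-elim (i≢j refl)
  ... | inj₂ (inj₁ refl) | inj₂ (inj₁ refl) = ⊥-elim (i≢j refl)
  ... | inj₂ (inj₂ refl) | inj₂ (inj₂ refl) = ⊥-elim (i≢j refl)

  3≤nonIsolatedCount : 3 ≤ nonIsolatedCount G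
  3≤nonIsolatedCount = begin
    3                          ≡⟨ ∑-corner* (λ _ → 1) ⟨
    ∑ (λ i → 𝟙 (corner i) * 1) ≤⟨ ∑-mono-≤ (λ i → ≤-trans (≤-reflexive (*-identityʳ _)) (cornerActive i)) ⟩
    nonIsolatedCount G         ∎
    where
    open ≤-Reasoning
    cornerActive : ∀ i → 𝟙 (corner i) ≤ 𝟙 (nonIsolated G i)
    cornerActive i with corner i in c
    ... | false = z≤n
    ... | true with corner⁻ {i} c
    ...   | inj₁ refl        rewrite adj⇒nonIsolated G xy = s≤s z≤n
    ...   | inj₂ (inj₁ refl) rewrite adj⇒nonIsolated G yz = s≤s z≤n
    ...   | inj₂ (inj₂ refl) rewrite adj⇒nonIsolated G (trans (Graph.sym G z x) xz) = s≤s z≤n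

  extend-saving : ∀ {s} → CliqueCoverSaving G⁻ s → CliqueCoverSaving G (2 + s)
  extend-saving {s} (F , cov , len) = triangle ∷ F , removeWithin-cover G corner triangle-isClique cov , (begin
    suc (length F) + (2 + s) ≡⟨ regroup (length F) s ⟩
    (length F + s) + 3       ≤⟨ +-monoˡ-≤ 3 len ⟩
    (edgeCount G⁻ + n) + 3   ≡⟨ swap-3 (edgeCount G⁻) n ⟩
    (edgeCount G⁻ + 3) + n   ≡⟨ cong (_+ n) edgeCount-G⁻ ⟨
    edgeCount G + n          ∎)
    where
    open ≤-Reasoning
    regroup : ∀ l s → suc l + (2 + s) ≡ (l + s) + 3
    regroup = solve-∀
    swap-3 : ∀ e n → (e + n) + 3 ≡ (e + 3) + n
    swap-3 = solve-∀

square≤square+1⇒≤ : ∀ {t k} → 2 ≤ t → t * t ≤ k * k + 1 → t ≤ k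
square≤square+1⇒≤ {t} {zero} 2≤t h with ≤-trans (*-mono-≤ 2≤t 2≤t) h
... | s≤s ()
square≤square+1⇒≤ {t} {suc k} 2≤t h with t ≤? suc k
... | yes t≤k = t≤k
... | no  t≰k = ⊥-elim (<⇒≱ gap (≤-trans (*-mono-≤ (≰⇒> t≰k) (≰⇒> t≰k)) h))
  where
  expand : ∀ k → (2 + k) * (2 + k) ≡ ((1 + k) * (1 + k) + 1) + suc (2 * k + 1)
  expand = solve-∀
  gap : suc k * suc k + 1 < (2 + k) * (2 + k)
  gap = subst (suc k * suc k + 1 <_) (≡.sym (expand k)) (m<m+n _ (s≤s z≤n))

square-bound-descends : ∀ {t e} → 2 ≤ t → (2 + t) * (2 + t) ≤ 4 * (e + 3) + 1 → t * t ≤ 4 * e + 1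
square-bound-descends {t} {e} 2≤t h = +-cancelʳ-≤ 12 (t * t) (4 * e + 1) (begin
  t * t + 12            ≤⟨ +-monoʳ-≤ (t * t) (+-monoˡ-≤ 4 (*-monoʳ-≤ 4 2≤t)) ⟩
  t * t + (4 * t + 4)   ≡⟨ lhs t ⟩
  (2 + t) * (2 + t)     ≤⟨ h ⟩
  4 * (e + 3) + 1       ≡⟨ rhs e ⟩
  4 * e + 1 + 12        ∎)
  where
  open ≤-Reasoning
  lhs : ∀ t → t * t + (4 * t + 4) ≡ (2 + t) * (2 + t)
  lhs = solve-∀
  rhs : ∀ e → 4 * (e + 3) + 1 ≡ 4 * e + 1 + 12
  rhs = solve-∀

HasTriangle : ∀ {n} → Graph n → Set
HasTriangle G = ∃ λ x → ∃ λ y → ∃ λ z → adj G x y ≡ true × adj G y z ≡ true × adj G x z ≡ true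

triangle? : ∀ {n} (G : Graph n) → Dec (HasTriangle G)
triangle? G = Finₚ.any? λ x → Finₚ.any? λ y → Finₚ.any? λ z →
  (adj G x y Boolₚ.≟ true) ×-dec (adj G y z Boolₚ.≟ true) ×-dec (adj G x z Boolₚ.≟ true)

cover-saving : ∀ {n} (G : Graph n) t → 2 ≤ t → t * t ≤ 4 * edgeCount G + 1 → CliqueCoverSaving G t
cover-saving G 1 (s≤s ()) _
cover-saving G (suc (suc s)) 2≤t bound with triangle? G | suc (suc s) ≤? 3
... | no noTriangle | _ =
  trivialCover-saving G (square≤square+1⇒≤ 2≤t (≤-trans bound (+-monoˡ-≤ 1 (mantel G triangleFree))))
  where
  triangleFree : TriangleFree G
  triangleFree x y z xy yz xz = noTriangle (x , y , z , xy , yz , xz)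
... | yes (_ , _ , _ , xy , yz , xz) | yes t≤3 = trivialCover-saving G (≤-trans t≤3 3≤nonIsolatedCount)
  where open Triangle G xy yz xz
... | yes (_ , _ , _ , xy , yz , xz) | no  t≰3 =
  extend-saving (cover-saving G⁻ s 2≤s bound⁻)
  where
  open Triangle G xy yz xz
  2≤s : 2 ≤ s
  2≤s with ≰⇒> t≰3
  ... | s≤s (s≤s 2≤s) = 2≤s
  bound⁻ : s * s ≤ 4 * edgeCount G⁻ + 1
  bound⁻ = square-bound-descends {e = edgeCount G⁻} 2≤s (subst (λ e → (2 + s) * (2 + s) ≤ 4 * e + 1) edgeCount-G⁻ bound)

-- The extremal graph

module CompleteBipartite {n : ℕ} (p q : ℕ) where

  left : Fin n → Bool
  left i = toℕ i <ᵇ p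

  right : Fin n → Bool
  right i = not (toℕ i <ᵇ p) ∧ (toℕ i <ᵇ p + q)

  graph : Graph n
  graph = record
    { adj    = λ i j → (left i ∧ right j) ∨ (right i ∧ left j)
    ; sym    = λ i j → trans (Boolₚ.∨-comm (left i ∧ right j) _)
                             (cong₂ _∨_ (Boolₚ.∧-comm (right i) (left j)) (Boolₚ.∧-comm (left i) (right j)))
    ; irrefl = loopless
    }
    where
    loopless : ∀ i → (left i ∧ right i) ∨ (right i ∧ left i) ≡ false
    loopless i with toℕ i <ᵇ p
    ... | true  = refl
    ... | false = Boolₚ.∧-zeroʳ _

  right⇒p≤ : ∀ {i} → right i ≡ true → p ≤ toℕ i
  right⇒p≤ {i} r with toℕ i <ᵇ p in e
  ... | false = <ᵇ-false⁻ (toℕ i) p e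

  side : ∀ {u v} → adj graph u v ≡ true → left u ≡ not (left v)
  side {u} {v} e with toℕ u <ᵇ p | toℕ v <ᵇ p | toℕ u <ᵇ p + q
  ... | true  | false | _ = refl
  ... | false | true  | _ = refl
  side () | true  | true  | _
  side () | false | false | true
  side () | false | false | false

  triangleFree : TriangleFree graph
  triangleFree x y z xy yz xz = Boolₚ.not-¬ refl (trans (≡.sym leftx≡leftz) (side xz))
    where
    leftx≡leftz : left x ≡ left z
    leftx≡leftz = trans (side xy) (trans (cong not (side yz)) (Boolₚ.not-involutive (left z)))

  forward-graph : ∀ i j → forward graph i j ≡ left i ∧ right j
  forward-graph i j = ∧-∨-select (toℕ i <ᵇ toℕ j) (left i ∧ right j) (right i ∧ left j) forwards backwards
    where
    forwards : left i ∧ right j ≡ true → (toℕ i <ᵇ toℕ j) ≡ true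
    forwards lr = let (l , r) = ∧-true⁻ lr in <ᵇ-true⁺ (<-≤-trans (<ᵇ-true⁻ (toℕ i) p l) (right⇒p≤ r))
    backwards : right i ∧ left j ≡ true → (toℕ i <ᵇ toℕ j) ≡ false
    backwards rl = let (r , l) = ∧-true⁻ rl in <ᵇ-false⁺ (<⇒≤ (<-≤-trans (<ᵇ-true⁻ (toℕ j) p l) (right⇒p≤ r)))

  module _ (p+q≤n : p + q ≤ n) where

    ∑-left : ∑ (𝟙 ∘ left) ≡ p
    ∑-left = ∑-<ᵇ n p (≤-trans (m≤m+n p q) p+q≤n)

    ∑-right : ∑ (𝟙 ∘ right) ≡ q
    ∑-right = +-cancelˡ-≡ p _ _ (begin
      p + ∑ (𝟙 ∘ right)                      ≡⟨ cong (_+ ∑ (𝟙 ∘ right)) ∑-left ⟨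
      ∑ (𝟙 ∘ left) + ∑ (𝟙 ∘ right)           ≡⟨ ∑-distrib-+ (𝟙 ∘ left) (𝟙 ∘ right) ⟨
      ∑ (λ i → 𝟙 (left i) + 𝟙 (right i))     ≡⟨ sum-cong-≗ leftOrRight ⟨
      ∑ {n} (λ i → 𝟙 (toℕ i <ᵇ p + q))       ≡⟨ ∑-<ᵇ n (p + q) p+q≤n ⟩
      p + q                                  ∎)
      where
      open ≡-Reasoning
      leftOrRight : ∀ i → 𝟙 (toℕ i <ᵇ p + q) ≡ 𝟙 (left i) + 𝟙 (right i)
      leftOrRight i with toℕ i <ᵇ p in e
      ... | false = refl
      ... | true rewrite <ᵇ-true⁺ (≤-trans (<ᵇ-true⁻ (toℕ i) p e) (m≤m+n p q)) = refl

    edgeCount-graph : edgeCount graph ≡ p * q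
    edgeCount-graph = begin
      edgeCount graph                                     ≡⟨ edgeCount-∑ graph ⟩
      ∑ (λ i → ∑ (λ j → 𝟙 (forward graph i j)))           ≡⟨ sum-cong-≗ (λ i → sum-cong-≗ λ j →
                                                               trans (cong 𝟙 (forward-graph i j)) (𝟙-∧ (left i) (right j))) ⟩
      ∑ (λ i → ∑ (λ j → 𝟙 (left i) * 𝟙 (right j)))        ≡⟨ sum-cong-≗ (λ i → ∑-*ˡ (𝟙 (left i)) (𝟙 ∘ right)) ⟩
      ∑ (λ i → 𝟙 (left i) * ∑ (𝟙 ∘ right))                ≡⟨ *-distribʳ-sum (∑ (𝟙 ∘ right)) (𝟙 ∘ left) ⟨
      ∑ (𝟙 ∘ left) * ∑ (𝟙 ∘ right)                        ≡⟨ cong₂ _*_ ∑-left ∑-right ⟩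
      p * q                                               ∎
      where open ≡-Reasoning

    nonIsolated-graph : 1 ≤ p → 1 ≤ q → ∀ i → nonIsolated graph i ≡ (toℕ i <ᵇ p + q)
    nonIsolated-graph 1≤p 1≤q i = byRange (toℕ i <ᵇ p + q) refl
      where
      p<p+q : p < p + q
      p<p+q = subst (_≤ p + q) (+-comm p 1) (+-monoʳ-≤ p 1≤q)
      firstRight : Fin n
      firstRight = fromℕ< (<-≤-trans p<p+q p+q≤n)
      right-firstRight : right firstRight ≡ true
      right-firstRight rewrite Finₚ.toℕ-fromℕ< (<-≤-trans p<p+q p+q≤n)
        = cong₂ (λ a b → not a ∧ b) (<ᵇ-false⁺ (≤-refl {p})) (<ᵇ-true⁺ p<p+q)
      firstLeft : Fin n
      firstLeft = fromℕ< (≤-trans 1≤p (≤-trans (m≤m+n p q) p+q≤n))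
      left-firstLeft : left firstLeft ≡ true
      left-firstLeft rewrite Finₚ.toℕ-fromℕ< (≤-trans 1≤p (≤-trans (m≤m+n p q) p+q≤n)) = <ᵇ-true⁺ 1≤p
      bySide : ∀ b → left i ≡ b → (toℕ i <ᵇ p + q) ≡ true → nonIsolated graph i ≡ true
      bySide true  l _ = adj⇒nonIsolated graph (cong₂ (λ a b → (a ∧ b) ∨ (right i ∧ left firstRight)) l right-firstRight)
      bySide false l e = adj⇒nonIsolated graph (cong₂ (λ a b → (a ∧ right firstLeft) ∨ b) l
                                                  (cong₂ _∧_ (cong₂ (λ a b → not a ∧ b) l e) left-firstLeft))
      byRange : ∀ b → (toℕ i <ᵇ p + q) ≡ b → nonIsolated graph i ≡ b
      byRange true  e = bySide (left i) refl e
      byRange false e = cong (0 <ᵇ_) (∑-zero λ j → cong 𝟙 (cong₂ (λ a b → (a ∧ right j) ∨ (b ∧ left j)) notLeft notRight))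
        where
        notLeft : left i ≡ false
        notLeft = <ᵇ-false⁺ (≤-trans (m≤m+n p q) (<ᵇ-false⁻ (toℕ i) (p + q) e))
        notRight : right i ≡ false
        notRight = trans (cong (not (left i) ∧_) e) (Boolₚ.∧-zeroʳ _)

    nonIsolatedCount-graph : 1 ≤ p → 1 ≤ q → nonIsolatedCount graph ≡ p + q
    nonIsolatedCount-graph 1≤p 1≤q =
      trans (sum-cong-≗ (cong 𝟙 ∘ nonIsolated-graph 1≤p 1≤q)) (∑-<ᵇ n (p + q) p+q≤n)

isBigTheta-product : ∀ {n p q m} → 1 ≤ p → 1 ≤ q → m ≡ p * q → 4 * m ≤ n * n → (p + q) * (p + q) ≤ 4 * m + 1 →
  IsBigTheta n m ((m + n) ∸ (p + q))
isBigTheta-product {n} {p} {q} {m} 1≤p 1≤q m≡pq 4m≤n² square =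
  (graph , trans (edgeCount-graph p+q≤n) (≡.sym m≡pq) , theta) , maximal
  where
  open CompleteBipartite {n} p q
  2≤p+q : 2 ≤ p + q
  2≤p+q = +-mono-≤ 1≤p 1≤q
  p+q≤n : p + q ≤ n
  p+q≤n = square≤square+1⇒≤ 2≤p+q (≤-trans square (+-monoˡ-≤ 1 4m≤n²))
  n-split : isolatedCount graph + (p + q) ≡ n
  n-split = trans (cong (isolatedCount graph +_) (≡.sym (nonIsolatedCount-graph p+q≤n 1≤p 1≤q)))
                  (isolatedCount+nonIsolatedCount graph)
  value : edgeCount graph + isolatedCount graph ≡ (m + n) ∸ (p + q)
  value = ≡.sym (begin
    (m + n) ∸ (p + q)                              ≡⟨ cong (λ x → (m + x) ∸ (p + q)) n-split ⟨
    (m + (isolatedCount graph + (p + q))) ∸ (p + q) ≡⟨ cong (_∸ (p + q)) (+-assoc m (isolatedCount graph) (p + q)) ⟨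
    (m + isolatedCount graph + (p + q)) ∸ (p + q)   ≡⟨ m+n∸n≡m (m + isolatedCount graph) (p + q) ⟩
    m + isolatedCount graph                        ≡⟨ cong (_+ isolatedCount graph)
                                                         (trans m≡pq (≡.sym (edgeCount-graph p+q≤n))) ⟩
    edgeCount graph + isolatedCount graph          ∎)
    where open ≡-Reasoning
  theta : IsTheta graph ((m + n) ∸ (p + q))
  theta = (trivialCover graph , trivialCover-isCliqueCover graph , trans (length-trivialCover graph) value) ,
          λ F cov → subst (_≤ length F) value (triangleFree-cover-length graph triangleFree cov)
  maximal : ∀ G → edgeCount G ≡ m → ∀ k → IsTheta G k → k ≤ (m + n) ∸ (p + q)
  maximal G eG k (_ , minimal) =
    let (F , cov , saving) = cover-saving G (p + q) 2≤p+q
                               (subst (λ e → (p + q) * (p + q) ≤ 4 * e + 1) (≡.sym eG) square)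
    in ≤-trans (minimal F cov) (m+n≤o⇒m≤o∸n (length F) (subst (λ e → length F + (p + q) ≤ e + n) eG saving))

lemma6 : ∀ (n p m : ℕ) → 4 ≤ n → 1 ≤ p → m ≤ (n * n) / 4 →
  (m ≡ p * p → IsBigTheta n m ((m + n) ∸ (2 * p)))
  × (m ≡ p * (p + 1) → IsBigTheta n m ((m + n) ∸ (2 * p + 1)))
lemma6 n p m _ 1≤p m≤n²/4 = square , oblong
  where
  4m≤n² : 4 * m ≤ n * n
  4m≤n² = ≤-trans (≤-reflexive (*-comm 4 m)) (≤-trans (*-monoˡ-≤ 4 m≤n²/4) (m/n*n≤m (n * n) 4))
  square : m ≡ p * p → IsBigTheta n m ((m + n) ∸ (2 * p))
  square m≡p² = subst (λ t → IsBigTheta n m ((m + n) ∸ t)) (p+p≡2p p)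
    (isBigTheta-product 1≤p 1≤p m≡p² 4m≤n²
      (≤-trans (≤-reflexive (trans (expand p) (cong (4 *_) (≡.sym m≡p²)))) (m≤m+n _ 1)))
    where
    p+p≡2p : ∀ p → p + p ≡ 2 * p
    p+p≡2p = solve-∀
    expand : ∀ p → (p + p) * (p + p) ≡ 4 * (p * p)
    expand = solve-∀
  oblong : m ≡ p * (p + 1) → IsBigTheta n m ((m + n) ∸ (2 * p + 1))
  oblong m≡p[p+1] = subst (λ t → IsBigTheta n m ((m + n) ∸ t)) (p+[p+1]≡2p+1 p)
    (isBigTheta-product 1≤p (m≤n+m 1 p) m≡p[p+1] 4m≤n²
      (≤-reflexive (trans (expand p) (cong (λ x → 4 * x + 1) (≡.sym m≡p[p+1])))))
    where
    p+[p+1]≡2p+1 : ∀ p → p + (p + 1) ≡ 2 * p + 1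
    p+[p+1]≡2p+1 = solve-∀
    expand : ∀ p → (p + (p + 1)) * (p + (p + 1)) ≡ 4 * (p * (p + 1)) + 1
    expand = solve-∀
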